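{- Let $\mathbf{A}$ be a complete BL-chain, $W\neq\emptyset$ a set, and consider the BL-algebra $\mathbf{A}^W$ of functions $W\to A$ with pointwise operations. Suppose $\mathcal{A}=\langle A^W,\forall,\exists\rangle$ is a c-EBL-algebra with focal element $c\in A^W$ such that $\sup_{w\in W}c(w)=1$ and $\forall A^W=A^*$, where $A^*$ is the set of constant maps $W\to A$. Then $\mathcal{P}^{\mathcal{A}}=\langle W,c\rangle$ is a possibilistic $\mathbf{A}$-frame, and its associated complex operators satisfy $\forall^{\mathcal{P}^{\mathcal{A}}}=\forall$ and $\exists^{\mathcal{P}^{\mathcal{A}}}=\exists$.
   Context: A BL-algebra is an algebra $\langle A,\wedge,\vee,\ast,\to,0,1\rangle$ such that $\langle A,\wedge,\vee,0,1\rangle$ is a bounded lattice (order $\le$), $\langle A,\ast,1\rangle$ is a commutative monoid, $a\ast b\le c$ iff $a\le b\to c$, and $a\wedge b=a\ast(a\to b)$ and $(a\to b)\vee(b\to a)=1$ hold. A BL-chain is a totally ordered BL-algebra; complete means every subset has a supremum and an infimum. An Epistemic BL-algebra (EBL-algebra) is a BL-algebra with unary operations $\forall,\exists$ satisfying, for all $a,b$: $\forall 1=1$; $\exists 0=0$; $\forall a\to\exists a=1$; $\forall(a\to\forall b)=\exists a\to\forall b$; $\forall(\forall a\to b)=\forall a\to\forall b$; $\exists a\to\forall\exists a=1$; $\forall(a\wedge b)=\forall a\wedge\forall b$; $\exists(a\vee b)=\exists a\vee\exists b$; $\exists(a\ast\exists b)=\exists a\ast\exists b$. The focal element is the least element of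 $\{a:\forall a=1\}$ when it exists; a c-EBL-algebra is an EBL-algebra in which the focal element exists. A possibilistic $\mathbf{A}$-frame is a pair $\langle W,\pi\rangle$ with $W\neq\emptyset$ and $\pi:W\to A$ with $\sup_{w\in W}\pi(w)=1$; for such a frame $\mathcal{P}$ and $f\in A^W$, $\forall^{\mathcal{P}}f$ is the constant function with value $\inf_{w\in W}\{\pi(w)\to f(w)\}$ and $\exists^{\mathcal{P}}f$ is the constant function with value $\sup_{w\in W}\{\pi(w)\ast f(w)\}$. -}

module Defs where

open import Level using (0ℓ)
open import Data.Product using (Σ; _×_; _,_; ∃)
open import Data.Sum using (_⊎_)
open import Relation.Binary.PropositionalEquality using (_≡_)

-- A BL-chain (totally ordered BL-algebra), equality is propositional
-- equality on the carrier; the lattice order is a ≤ b :⇔ a ∧ b ≡ a.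
record BLChain : Set₁ where
  infixr 6 _∧_
  infixr 5 _∨_
  infixr 7 _*_
  infixr 4 _⇒_
  infix 3 _≤_
  field
    Carrier : Set
    _∧_ _∨_ _*_ _⇒_ : Carrier → Carrier → Carrier
    𝟘 𝟙 : Carrier
    ∧-comm   : ∀ a b → a ∧ b ≡ b ∧ a
    ∧-assoc  : ∀ a b c → (a ∧ b) ∧ c ≡ a ∧ (b ∧ c)
    ∨-comm   : ∀ a b → a ∨ b ≡ b ∨ a
    ∨-assoc  : ∀ a b c → (a ∨ b) ∨ c ≡ a ∨ (b ∨ c)
    ∧-absorbs-∨ : ∀ a b → a ∧ (a ∨ b) ≡ a
    ∨-absorbs-∧ : ∀ a b → a ∨ (a ∧ b) ≡ a
  _≤_ : Carrier → Carrier → Set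
  a ≤ b = a ∧ b ≡ a
  field
    𝟘-least  : ∀ a → 𝟘 ≤ a
    𝟙-great  : ∀ a → a ≤ 𝟙
    *-comm   : ∀ a b → a * b ≡ b * a
    *-assoc  : ∀ a b c → (a * b) * c ≡ a * (b * c)
    *-identityʳ : ∀ a → a * 𝟙 ≡ a
    residuated : ∀ a b c → (a * b ≤ c → a ≤ (b ⇒ c)) × (a ≤ (b ⇒ c) → a * b ≤ c)
    divisibility : ∀ a b → a ∧ b ≡ a * (a ⇒ b)
    prelinearity : ∀ a b → (a ⇒ b) ∨ (b ⇒ a) ≡ 𝟙
    total : ∀ a b → a ≤ b ⊎ b ≤ a

  IsSup : (Carrier → Set) → Carrier → Set
  IsSup P s = (∀ x → P x → x ≤ s) × (∀ u → (∀ x → P x → x ≤ u) → s ≤ u)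

  IsInf : (Carrier → Set) → Carrier → Set
  IsInf P i = (∀ x → P x → i ≤ x) × (∀ l → (∀ x → P x → l ≤ x) → l ≤ i)

IsComplete : BLChain → Set₁
IsComplete A = ∀ (P : Carrier → Set) → Σ Carrier (IsSup P) × Σ Carrier (IsInf P)
  where open BLChain A

module Power (A : BLChain) (W : Set) where
  open BLChain A

  F : Set
  F = W → Carrier

  _≐_ : F → F → Set
  f ≐ g = ∀ w → f w ≡ g w

  _≤ᶠ_ : F → F → Set
  f ≤ᶠ g = ∀ w → f w ≤ g w

  infix 3 _≐_ _≤ᶠ_
  infixr 6 _∧ᶠ_
  infixr 5 _∨ᶠ_
  infixr 7 _*ᶠ_
  infixr 4 _⇒ᶠ_
  _∧ᶠ_ _∨ᶠ_ _*ᶠ_ _⇒ᶠ_ : F → F → F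
  (f ∧ᶠ g) w = f w ∧ g w
  (f ∨ᶠ g) w = f w ∨ g w
  (f *ᶠ g) w = f w * g w
  (f ⇒ᶠ g) w = f w ⇒ g w

  const : Carrier → F
  const a _ = a

  𝟘ᶠ 𝟙ᶠ : F
  𝟘ᶠ = const 𝟘
  𝟙ᶠ = const 𝟙

  -- ⟨A^W, ∀, ∃⟩ is an EBL-algebra.  Since elements of A^W are functions,
  -- the operators must be well defined on (extensionally equal) functions.
  record IsEBL (∀' ∃' : F → F) : Set where
    field
      ∀-cong : ∀ f g → f ≐ g → ∀' f ≐ ∀' g
      ∃-cong : ∀ f g → f ≐ g → ∃' f ≐ ∃' g
      ax1 : ∀' 𝟙ᶠ ≐ 𝟙ᶠ
      ax2 : ∃' 𝟘ᶠ ≐ 𝟘ᶠ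
      ax3 : ∀ a → (∀' a ⇒ᶠ ∃' a) ≐ 𝟙ᶠ
      ax4 : ∀ a b → ∀' (a ⇒ᶠ ∀' b) ≐ (∃' a ⇒ᶠ ∀' b)
      ax5 : ∀ a b → ∀' (∀' a ⇒ᶠ b) ≐ (∀' a ⇒ᶠ ∀' b)
      ax6 : ∀ a → (∃' a ⇒ᶠ ∀' (∃' a)) ≐ 𝟙ᶠ
      ax7 : ∀ a b → ∀' (a ∧ᶠ b) ≐ (∀' a ∧ᶠ ∀' b)
      ax8 : ∀ a b → ∃' (a ∨ᶠ b) ≐ (∃' a ∨ᶠ ∃' b)
      ax9 : ∀ a b → ∃' (a *ᶠ ∃' b) ≐ (∃' a *ᶠ ∃' b)

  IsFocal : (F → F) → F → Set
  IsFocal ∀' c = (∀' c ≐ 𝟙ᶠ) × (∀ a → ∀' a ≐ 𝟙ᶠ → c ≤ᶠ a)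

  ImageIsConstants : (F → F) → Set
  ImageIsConstants ∀' =
    (∀ f → ∃ λ a → ∀' f ≐ const a) × (∀ a → ∃ λ f → ∀' f ≐ const a)

IsPossFrame : (A : BLChain) (W : Set) → (W → BLChain.Carrier A) → Set
IsPossFrame A W π = W × IsSup (λ x → ∃ λ w → x ≡ π w) 𝟙
  where open BLChain A

-- the complex operators of a frame ⟨W, π⟩, given relationally:
-- ∀ᴾ f is the constant function with value inf_w (π w ⇒ f w), and
-- ∃ᴾ f is the constant function with value sup_w (π w * f w).
module _ (A : BLChain) (W : Set) (π : W → BLChain.Carrier A) where
  open BLChain A
  open Power A W

  IsFrameBox : F → F → Set
  IsFrameBox f g = ∀ v → IsInf (λ x → ∃ λ w → x ≡ (π w ⇒ f w)) (g v)

  IsFrameDiamond : F → F → Set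
  IsFrameDiamond f g = ∀ v → IsSup (λ x → ∃ λ w → x ≡ (π w * f w)) (g v)

-- The focal element c turns every statement "∀ h = 1" into "c ≤ h".  Since the
-- image of ∀ consists of the constants, axioms (4) and (5) specialise to
-- ∀ (f ⇒ l) = ∃ f ⇒ l and ∀ (l ⇒ f) = l ⇒ ∀ f for constants l, and ∀ f, ∃ f
-- are constant.  Hence for every constant l
--   l ≤ ∀ f  ⇔  c ≤ l ⇒ f  ⇔  ∀ w, l ≤ c w ⇒ f w,
--   ∃ f ≤ l  ⇔  c ≤ f ⇒ l  ⇔  ∀ w, c w * f w ≤ l,
-- which say that ∀ f is the infimum of the c w ⇒ f w and ∃ f the supremum of
-- the c w * f w.
module Submission where

open import Defs
open import Data.Product using (_×_; ∃; _,_; proj₁; proj₂)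
open import Function.Bundles using (_⇔_; mk⇔; Equivalence)
open import Relation.Binary.PropositionalEquality
  using (_≡_; refl; sym; trans; cong; cong₂; subst; module ≡-Reasoning)

open Equivalence using (to; from)

module BLChainProperties (A : BLChain) where
  open BLChain A

  ∧-idem : ∀ a → a ∧ a ≡ a
  ∧-idem a = trans (cong (a ∧_) (sym (∨-absorbs-∧ a a))) (∧-absorbs-∨ a (a ∧ a))

  ≤-refl : ∀ {a} → a ≤ a
  ≤-refl {a} = ∧-idem a

  ≤-antisym : ∀ {a b} → a ≤ b → b ≤ a → a ≡ b
  ≤-antisym {a} {b} p q = trans (sym p) (trans (∧-comm a b) q)

  𝟙≤⇒≡𝟙 : ∀ {a} → 𝟙 ≤ a → a ≡ 𝟙
  𝟙≤⇒≡𝟙 {a} = ≤-antisym (𝟙-great a)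

  *-identityˡ : ∀ a → 𝟙 * a ≡ a
  *-identityˡ a = trans (*-comm 𝟙 a) (*-identityʳ a)

  ≤⇔⇒≡𝟙 : ∀ {a b} → (a ≤ b) ⇔ ((a ⇒ b) ≡ 𝟙)
  ≤⇔⇒≡𝟙 {a} {b} = mk⇔
    (λ a≤b → 𝟙≤⇒≡𝟙 (proj₁ (residuated 𝟙 a b) (subst (_≤ b) (sym (*-identityˡ a)) a≤b)))
    (λ a⇒b≡𝟙 → subst (_≤ b) (*-identityˡ a)
      (proj₂ (residuated 𝟙 a b) (subst (𝟙 ≤_) (sym a⇒b≡𝟙) ≤-refl)))

  *≤⇔≤⇒ : ∀ {a b c} → (a * b ≤ c) ⇔ (a ≤ (b ⇒ c))
  *≤⇔≤⇒ {a} {b} {c} = mk⇔ (proj₁ (residuated a b c)) (proj₂ (residuated a b c))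

  ≤⇒-swap : ∀ {a b c} → a ≤ (b ⇒ c) → b ≤ (a ⇒ c)
  ≤⇒-swap {a} {b} {c} p =
    to *≤⇔≤⇒ (subst (_≤ c) (*-comm a b) (from *≤⇔≤⇒ p))

module PowerProperties (A : BLChain) (W : Set) where
  open BLChain A
  open Power A W
  open BLChainProperties A

  Constant : F → Set
  Constant φ = ∀ u v → φ u ≡ φ v

  const-constant : ∀ a → Constant (const a)
  const-constant a u v = refl

  ⇒ᶠ≐𝟙ᶠ⇔≤ : ∀ {φ ψ} → Constant φ → Constant ψ → ∀ v → ((φ ⇒ᶠ ψ) ≐ 𝟙ᶠ) ⇔ (φ v ≤ ψ v)
  ⇒ᶠ≐𝟙ᶠ⇔≤ {φ} {ψ} φ-const ψ-const v = mk⇔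
    (λ φ⇒ψ≐𝟙 → from ≤⇔⇒≡𝟙 (φ⇒ψ≐𝟙 v))
    (λ φv≤ψv u → trans (cong₂ _⇒_ (φ-const u v) (ψ-const u v)) (to ≤⇔⇒≡𝟙 φv≤ψv))

module EBLProperties (A : BLChain) (W : Set)
  {∀' ∃' : Power.F A W → Power.F A W} (ebl : Power.IsEBL A W ∀' ∃')
  {c : Power.F A W} (focal : Power.IsFocal A W ∀' c)
  (image : Power.ImageIsConstants A W ∀') where
  open BLChain A
  open Power A W
  open IsEBL ebl
  open BLChainProperties A
  open PowerProperties A W

  ∀-mono : ∀ {f g} → f ≤ᶠ g → ∀' f ≤ᶠ ∀' g
  ∀-mono {f} {g} f≤g w = trans (sym (ax7 f g w)) (∀-cong (f ∧ᶠ g) f f≤g w)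

  ∀≐𝟙ᶠ⇔focal≤ : ∀ {h} → (∀' h ≐ 𝟙ᶠ) ⇔ (c ≤ᶠ h)
  ∀≐𝟙ᶠ⇔focal≤ {h} = mk⇔ (proj₂ focal h)
    (λ c≤h w → 𝟙≤⇒≡𝟙 (subst (_≤ ∀' h w) (proj₁ focal w) (∀-mono c≤h w)))

  ∀-constant : ∀ f → Constant (∀' f)
  ∀-constant f u v = trans (proj₂ (proj₁ image f) u) (sym (proj₂ (proj₁ image f) v))

  ∀-const-⇒ : ∀ l f → ∀' (const l ⇒ᶠ f) ≐ (const l ⇒ᶠ ∀' f)
  ∀-const-⇒ l f w with proj₂ image l
  ... | g , ∀g≐l = begin
    ∀' (const l ⇒ᶠ f) w  ≡⟨ ∀-cong _ _ (λ u → cong (_⇒ f u) (sym (∀g≐l u))) w ⟩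
    ∀' (∀' g ⇒ᶠ f) w     ≡⟨ ax5 g f w ⟩
    (∀' g w ⇒ ∀' f w)    ≡⟨ cong (_⇒ ∀' f w) (∀g≐l w) ⟩
    (l ⇒ ∀' f w)         ∎
    where open ≡-Reasoning

  ∀-⇒-const : ∀ f l → ∀' (f ⇒ᶠ const l) ≐ (∃' f ⇒ᶠ const l)
  ∀-⇒-const f l w with proj₂ image l
  ... | g , ∀g≐l = begin
    ∀' (f ⇒ᶠ const l) w  ≡⟨ ∀-cong _ _ (λ u → cong (f u ⇒_) (sym (∀g≐l u))) w ⟩
    ∀' (f ⇒ᶠ ∀' g) w     ≡⟨ ax4 f g w ⟩
    (∃' f w ⇒ ∀' g w)    ≡⟨ cong (∃' f w ⇒_) (∀g≐l w) ⟩
    (∃' f w ⇒ l)         ∎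
    where open ≡-Reasoning

  -- ∃ f ⇒ ∃ f v equals the constant ∀ (f ⇒ ∃ f v) and is 𝟙 at v, hence everywhere.
  ∃-constant : ∀ f → Constant (∃' f)
  ∃-constant f u v = ≤-antisym (≤-at u v) (≤-at v u)
    where
    ≤-at : ∀ u v → ∃' f u ≤ ∃' f v
    ≤-at u v = from ≤⇔⇒≡𝟙 (begin
      (∃' f u ⇒ ∃' f v)               ≡⟨ sym (∀-⇒-const f (∃' f v) u) ⟩
      ∀' (f ⇒ᶠ const (∃' f v)) u      ≡⟨ ∀-constant _ u v ⟩
      ∀' (f ⇒ᶠ const (∃' f v)) v      ≡⟨ ∀-⇒-const f (∃' f v) v ⟩
      (∃' f v ⇒ ∃' f v)               ≡⟨ to ≤⇔⇒≡𝟙 ≤-refl ⟩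
      𝟙                               ∎)
      where open ≡-Reasoning

  const≤∀⇔focal≤ : ∀ l f v → (l ≤ ∀' f v) ⇔ (c ≤ᶠ (const l ⇒ᶠ f))
  const≤∀⇔focal≤ l f v = mk⇔
    (λ l≤∀f → to ∀≐𝟙ᶠ⇔focal≤ (λ w → trans (∀-const-⇒ l f w)
      (from (⇒ᶠ≐𝟙ᶠ⇔≤ (const-constant l) (∀-constant f) v) l≤∀f w)))
    (λ c≤l⇒f → to (⇒ᶠ≐𝟙ᶠ⇔≤ (const-constant l) (∀-constant f) v)
      (λ w → trans (sym (∀-const-⇒ l f w)) (from ∀≐𝟙ᶠ⇔focal≤ c≤l⇒f w)))

  ∃≤const⇔focal≤ : ∀ f l v → (∃' f v ≤ l) ⇔ (c ≤ᶠ (f ⇒ᶠ const l))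
  ∃≤const⇔focal≤ f l v = mk⇔
    (λ ∃f≤l → to ∀≐𝟙ᶠ⇔focal≤ (λ w → trans (∀-⇒-const f l w)
      (from (⇒ᶠ≐𝟙ᶠ⇔≤ (∃-constant f) (const-constant l) v) ∃f≤l w)))
    (λ c≤f⇒l → to (⇒ᶠ≐𝟙ᶠ⇔≤ (∃-constant f) (const-constant l) v)
      (λ w → trans (sym (∀-⇒-const f l w)) (from ∀≐𝟙ᶠ⇔focal≤ c≤f⇒l w)))

  ∀-isFrameBox : ∀ f → IsFrameBox A W c f (∀' f)
  ∀-isFrameBox f v = lower , greatest
    where
    lower : ∀ x → (∃ λ w → x ≡ (c w ⇒ f w)) → ∀' f v ≤ x
    lower x (w , refl) = ≤⇒-swap (to (const≤∀⇔focal≤ (∀' f v) f v) ≤-refl w)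
    greatest : ∀ l → (∀ x → (∃ λ w → x ≡ (c w ⇒ f w)) → l ≤ x) → l ≤ ∀' f v
    greatest l lower-bound =
      from (const≤∀⇔focal≤ l f v) (λ w → ≤⇒-swap (lower-bound _ (w , refl)))

  ∃-isFrameDiamond : ∀ f → IsFrameDiamond A W c f (∃' f)
  ∃-isFrameDiamond f v = upper , least
    where
    upper : ∀ x → (∃ λ w → x ≡ (c w * f w)) → x ≤ ∃' f v
    upper x (w , refl) = from *≤⇔≤⇒ (to (∃≤const⇔focal≤ f (∃' f v) v) ≤-refl w)
    least : ∀ u → (∀ x → (∃ λ w → x ≡ (c w * f w)) → x ≤ u) → ∃' f v ≤ u
    least u upper-bound =
      from (∃≤const⇔focal≤ f u v) (λ w → to *≤⇔≤⇒ (upper-bound _ (w , refl)))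

theorem11 : (A : BLChain) → IsComplete A → (W : Set) → W →
    (∀' ∃' : Power.F A W → Power.F A W) → Power.IsEBL A W ∀' ∃' →
    (c : Power.F A W) → Power.IsFocal A W ∀' c →
    BLChain.IsSup A (λ x → ∃ λ w → x ≡ c w) (BLChain.𝟙 A) →
    Power.ImageIsConstants A W ∀' →
    IsPossFrame A W c
      × (∀ f → IsFrameBox A W c f (∀' f))
      × (∀ f → IsFrameDiamond A W c f (∃' f))
theorem11 A _ W w₀ ∀' ∃' ebl c focal sup-c≡𝟙 image =
  (w₀ , sup-c≡𝟙) , ∀-isFrameBox , ∃-isFrameDiamond
  where open EBLProperties A W ebl focal image
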